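{- Let $k\ge 2$ and let $G_k$ be the vertex-weighted undirected graph defined below, with terminal set $T=A\cup D$ and non-terminal set $N=\{v_{i,j}\}$. For $B\subseteq N$ let $G_k^B$ be the subgraph of $G_k$ induced by $T\cup(N\setminus B)$. Let $i\neq j$ be indices in $\{1,\dots,k\}$ and $X_{i,j}=\{a_i\}\cup(D\setminus\{d_j\})$. Then $\mathrm{mincut}_{G_k^B}(X_{i,j},T\setminus X_{i,j})=2k-4$ if and only if $v_{i,j}\in B$.
   Context: $G_k$ has terminals $A=\{a_1,\dots,a_k\}$, $D=\{d_1,\dots,d_k\}$ with weights $w(a_i)=2$, $w(d_i)=4$, an edge $\{a_i,d_i\}$ for each $i$, and for every unordered pair $\{i,j\}$ of distinct indices a non-terminal $v_{i,j}=v_{j,i}$ of weight $1$ adjacent to exactly $a_i$ and $a_j$. For a graph $H$ and vertex sets $P,Q$, a $(P,Q)$-vertex-cut is a set $C$ of vertices (possibly containing terminals) such that for all $p\in P\setminus C$, $q\in Q\setminus C$ there is no path from $p$ to $q$ in $H\setminus C$; $\mathrm{mincut}_H(P,Q)$ is the minimum total weight of such a cut. -}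

module Defs where

open import Data.Nat using (ℕ; zero; suc; _+_; _≤_)
open import Data.Fin using (Fin; _<_; _<?_; _≟_)
open import Data.Fin.Properties using (<-cmp)
open import Data.Bool using (Bool; true; false; not; _∧_; _∨_; if_then_else_)
open import Data.List using (List; []; _∷_; _++_; map; concatMap; allFin)
open import Data.Nat.ListAction using (sum)
open import Data.Product using (Σ; _×_; _,_)
open import Data.Empty using (⊥; ⊥-elim)
open import Relation.Nullary using (¬_; yes; no)
open import Relation.Nullary.Decidable using (⌊_⌋)
open import Relation.Binary.PropositionalEquality using (_≡_; _≢_)
open import Relation.Binary.Definitions using (tri<; tri≈; tri>)

-- Vertices of G_k.
-- a i, d i : terminals a_i, d_i.
-- v i j p  : the non-terminal v_{i,j} = v_{j,i}, stored canonically with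
--            i < j (the proof is irrelevant, so each unordered pair gives
--            exactly one vertex).

data V (k : ℕ) : Set where
  a : Fin k → V k
  d : Fin k → V k
  v : (i j : Fin k) → .(i < j) → V k

vtx : ∀ {k} (i j : Fin k) → i ≢ j → V k
vtx i j i≢j with <-cmp i j
... | tri< p _ _ = v i j p
... | tri≈ _ e _ = ⊥-elim (i≢j e)
... | tri> _ _ q = v j i q

w : ∀ {k} → V k → ℕ
w (a _) = 2
w (d _) = 4
w (v _ _ _) = 1

isTerminal : ∀ {k} → V k → Bool
isTerminal (a _) = true
isTerminal (d _) = true
isTerminal (v _ _ _) = false

data Adj {k : ℕ} : V k → V k → Set where
  ad : ∀ i → Adj (a i) (d i)
  da : ∀ i → Adj (d i) (a i)
  va₁ : ∀ i j .(p : i < j) → Adj (v i j p) (a i)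
  va₂ : ∀ i j .(p : i < j) → Adj (v i j p) (a j)
  av₁ : ∀ i j .(p : i < j) → Adj (a i) (v i j p)
  av₂ : ∀ i j .(p : i < j) → Adj (a j) (v i j p)

pairsWith : ∀ {k} → Fin k → List (V k)
pairsWith {k} i = concatMap f (allFin k)
  where
  f : Fin k → List (V k)
  f j with i <? j
  ... | yes p = v i j p ∷ []
  ... | no _ = []

allV : (k : ℕ) → List (V k)
allV k = map a (allFin k) ++ map d (allFin k) ++ concatMap pairsWith (allFin k)

VSet : ℕ → Set
VSet k = V k → Bool

_∈_ : ∀ {k} → V k → VSet k → Set
x ∈ S = S x ≡ true

_∉_ : ∀ {k} → V k → VSet k → Set
x ∉ S = S x ≡ false

weight : ∀ {k} → VSet k → ℕ
weight {k} C = sum (map (λ x → if C x then w x else 0) (allV k))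

inGB : ∀ {k} → VSet k → VSet k
inGB B x = isTerminal x ∨ not (B x)

-- Paths in the induced subgraph of G_k on the vertices satisfying `ok`
data Reach {k : ℕ} (ok : V k → Set) : V k → V k → Set where
  here : ∀ {x} → ok x → Reach ok x x
  step : ∀ {x y z} → ok x → Adj x y → Reach ok y z → Reach ok x z

-- C is a (P,Q)-vertex-cut of G_k^B (C ⊆ V(G_k^B); terminals allowed)
IsCut : ∀ {k} → (B P Q C : VSet k) → Set
IsCut {k} B P Q C =
  (∀ x → x ∈ C → x ∈ inGB B) ×
  (∀ p q → p ∈ P → p ∉ C → q ∈ Q → q ∉ C →
     ¬ Reach (λ x → (x ∈ inGB B) × (x ∉ C)) p q)

MinCutIs : ∀ {k} → (B P Q : VSet k) → ℕ → Set
MinCutIs {k} B P Q m =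
  Σ (VSet k) (λ C → IsCut B P Q C × weight C ≡ m) ×
  (∀ C → IsCut B P Q C → m ≤ weight C)

X : ∀ {k} → Fin k → Fin k → VSet k
X i j (a l) = ⌊ l ≟ i ⌋
X i j (d l) = not ⌊ l ≟ j ⌋
X i j (v _ _ _) = false

TMinus : ∀ {k} → VSet k → VSet k
TMinus S x = isTerminal x ∧ not (S x)

-- A cut must contain a_l or d_l for every l ∉ {i, j}, since d_l ∈ X_{i,j} and
-- a_l ∉ X_{i,j} are adjacent; each such pair costs at least 2, so every cut
-- weighs at least 2(k − 2).  If v_{i,j} survives in G_k^B, the path
-- a_i v_{i,j} a_j forces a further vertex into the cut.  If v_{i,j} ∈ B, then
-- A ∖ {a_i, a_j} is a cut of weight 2(k − 2): after deleting it, the side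
-- {a_i} ∪ (D ∖ {d_j}) ∪ {v_{i,m}} of X_{i,j} has no surviving outgoing edge.
module Submission where

open import Defs
open import Data.Bool using (true; false; not; _∧_; _∨_; if_then_else_)
open import Data.Bool.Properties using (T-≡; ∧-zeroʳ; ∨-zeroʳ; not-involutive)
open import Data.Empty using (⊥-elim)
open import Data.Fin using (Fin; zero; suc; _<_; _<?_; _≟_; punchIn; punchOut)
open import Data.Fin.Properties
  using (<-cmp; <-asym; punchInᵢ≢i; punchIn-injective; punchIn-punchOut)
open import Data.List using (List; []; _∷_; _++_; map; concatMap; allFin; tabulate)
open import Data.List.Membership.Propositional using (lose) renaming (_∈_ to _∈ₗ_)
open import Data.List.Membership.Propositional.Properties
  using (∈-concatMap⁺; ∈-concatMap⁻; ∈-allFin)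
open import Data.List.Properties using (map-++; map-∘; map-tabulate)
open import Data.List.Relation.Unary.Any using (here; there; satisfied)
open import Data.Nat using (ℕ; zero; suc; _+_; _*_; _∸_; _≤_; z≤n; s≤s)
open import Data.Nat.ListAction using (sum)
open import Data.Nat.ListAction.Properties using (sum-++)
open import Data.Nat.Properties
  using ( +-0-commutativeMonoid; +-assoc; +-comm; +-identityʳ; *-comm; *-distribˡ-+; m+n∸m≡n
        ; ≤-trans; m≤m+n; m≤n+m; m+1+n≰m; +-mono-≤; +-monoˡ-≤; +-monoʳ-≤
        ; module ≤-Reasoning)
open import Algebra.Properties.CommutativeMonoid.Sum +-0-commutativeMonoid
  using (sum-remove; sum-cong-≗; sum-replicate-zero; ∑-distrib-+)
  renaming (sum to ∑)
open import Data.Product using (_×_; _,_; proj₁; proj₂)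
open import Data.Sum using (_⊎_; inj₁; inj₂)
open import Function using (_∘_; _∋_; case_of_)
open import Function.Bundles using (_⇔_; mk⇔; Equivalence)
open import Relation.Binary.Definitions using (tri<; tri≈; tri>)
open import Relation.Binary.PropositionalEquality
  using (_≡_; _≢_; refl; sym; trans; cong; cong₂; subst; module ≡-Reasoning)
open import Relation.Nullary using (¬_; yes; no)
open import Relation.Nullary.Decidable
  using (⌊_⌋; recompute; toWitness; toWitnessFalse; fromWitness; fromWitnessFalse)

private
  variable
    k n : ℕ

sum-tabulate : (f : Fin n → ℕ) → sum (tabulate f) ≡ ∑ f
sum-tabulate {zero}  f = refl
sum-tabulate {suc n} f = cong (f zero +_) (sum-tabulate (f ∘ suc))

sum-map-allFin : (f : Fin n → ℕ) → sum (map f (allFin n)) ≡ ∑ f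
sum-map-allFin f = trans (cong sum (map-tabulate (λ l → l) f)) (sum-tabulate f)

∑-mono-≤ : {f g : Fin n → ℕ} → (∀ l → f l ≤ g l) → ∑ f ≤ ∑ g
∑-mono-≤ {zero}  f≤g = z≤n
∑-mono-≤ {suc n} f≤g = +-mono-≤ (f≤g zero) (∑-mono-≤ (f≤g ∘ suc))

∑-const : (n c : ℕ) → ∑ {n} (λ _ → c) ≡ n * c
∑-const zero    c = refl
∑-const (suc n) c = cong (c +_) (∑-const n c)

-- The n indices of Fin (2 + n) other than two given distinct ones.
punchIn₂ : {i j : Fin (suc (suc n))} → i ≢ j → Fin n → Fin (suc (suc n))
punchIn₂ {i = i} i≢j l = punchIn i (punchIn (punchOut i≢j) l)

punchIn₂≢ˡ : {i j : Fin (suc (suc n))} (i≢j : i ≢ j) (l : Fin n) → punchIn₂ i≢j l ≢ i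
punchIn₂≢ˡ {i = i} i≢j l = punchInᵢ≢i i _

punchIn₂≢ʳ : {i j : Fin (suc (suc n))} (i≢j : i ≢ j) (l : Fin n) → punchIn₂ i≢j l ≢ j
punchIn₂≢ʳ {i = i} i≢j l eq =
  punchInᵢ≢i (punchOut i≢j) l (punchIn-injective i _ _ (trans eq (sym (punchIn-punchOut i≢j))))

sum-remove₂ : (f : Fin (suc (suc n)) → ℕ) {i j : Fin (suc (suc n))} (i≢j : i ≢ j) →
              ∑ f ≡ f i + (f j + ∑ (f ∘ punchIn₂ i≢j))
sum-remove₂ f {i} {j} i≢j = begin
  ∑ f                                          ≡⟨ sum-remove f ⟩
  f i + ∑ (f ∘ punchIn i)                      ≡⟨ cong (f i +_) (sum-remove (f ∘ punchIn i)) ⟩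
  f i + (f (punchIn i (punchOut i≢j)) + rest)  ≡⟨ cong (λ l → f i + (f l + rest)) (punchIn-punchOut i≢j) ⟩
  f i + (f j + rest)                           ∎
  where
  open ≡-Reasoning
  rest : ℕ
  rest = ∑ (f ∘ punchIn₂ i≢j)

∑-≥-except₂ : (f : Fin (suc (suc n)) → ℕ) {i j : Fin (suc (suc n))} → i ≢ j → (c : ℕ) →
              (∀ l → l ≢ i → l ≢ j → c ≤ f l) → n * c + (f i + f j) ≤ ∑ f
∑-≥-except₂ {n} f {i} {j} i≢j c c≤f = begin
  n * c + (f i + f j)            ≡⟨ cong (_+ (f i + f j)) (∑-const n c) ⟨
  ∑ {n} (λ _ → c) + (f i + f j)  ≤⟨ +-monoˡ-≤ (f i + f j) (∑-mono-≤ c≤rest) ⟩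
  rest + (f i + f j)             ≡⟨ +-comm rest (f i + f j) ⟩
  (f i + f j) + rest             ≡⟨ +-assoc (f i) (f j) rest ⟩
  f i + (f j + rest)             ≡⟨ sum-remove₂ f i≢j ⟨
  ∑ f                            ∎
  where
  open ≤-Reasoning
  rest : ℕ
  rest = ∑ (f ∘ punchIn₂ i≢j)
  c≤rest : ∀ l → c ≤ f (punchIn₂ i≢j l)
  c≤rest l = c≤f _ (punchIn₂≢ˡ i≢j l) (punchIn₂≢ʳ i≢j l)

∑-≡-except₂ : (f : Fin (suc (suc n)) → ℕ) {i j : Fin (suc (suc n))} → i ≢ j → (c : ℕ) →
              (∀ l → l ≢ i → l ≢ j → f l ≡ c) → ∑ f ≡ f i + (f j + n * c)
∑-≡-except₂ {n} f {i} {j} i≢j c f≡c = begin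
  ∑ f                                 ≡⟨ sum-remove₂ f i≢j ⟩
  f i + (f j + ∑ (f ∘ punchIn₂ i≢j))  ≡⟨ cong (λ s → f i + (f j + s)) (sum-cong-≗ f≡c-rest) ⟩
  f i + (f j + ∑ {n} (λ _ → c))       ≡⟨ cong (λ s → f i + (f j + s)) (∑-const n c) ⟩
  f i + (f j + n * c)                 ∎
  where
  open ≡-Reasoning
  f≡c-rest : ∀ l → f (punchIn₂ i≢j l) ≡ c
  f≡c-rest l = f≡c _ (punchIn₂≢ˡ i≢j l) (punchIn₂≢ʳ i≢j l)

sum-map-∈-≤ : {A : Set} (g : A → ℕ) {x : A} {xs : List A} → x ∈ₗ xs → g x ≤ sum (map g xs)
sum-map-∈-≤ g {xs = y ∷ xs} (here refl) = m≤m+n (g y) _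
sum-map-∈-≤ g {xs = y ∷ xs} (there x∈xs) = ≤-trans (sum-map-∈-≤ g x∈xs) (m≤n+m _ (g y))

sum-map-zero : {A : Set} (g : A → ℕ) (xs : List A) → (∀ x → x ∈ₗ xs → g x ≡ 0) →
               sum (map g xs) ≡ 0
sum-map-zero g [] g≡0 = refl
sum-map-zero g (x ∷ xs) g≡0 =
  cong₂ _+_ (g≡0 x (here refl)) (sum-map-zero g xs (λ y y∈xs → g≡0 y (there y∈xs)))

cost : VSet k → V k → ℕ
cost C x = if C x then w x else 0

cost-∉ : (C : VSet k) {x : V k} → x ∉ C → cost C x ≡ 0
cost-∉ C {x} x∉C = cong (λ b → if b then w x else 0) x∉C

w-positive : (x : V k) → 1 ≤ w x
w-positive (a _)     = s≤s z≤n
w-positive (d _)     = s≤s z≤n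
w-positive (v _ _ _) = s≤s z≤n

nonTerminals : (k : ℕ) → List (V k)
nonTerminals k = concatMap pairsWith (allFin k)

weight-decomposition : (C : VSet k) →
  weight C ≡ ∑ (cost C ∘ a) + (∑ (cost C ∘ d) + sum (map (cost C) (nonTerminals k)))
weight-decomposition {k} C = begin
  sum (map (cost C) (map a L ++ map d L ++ N))
    ≡⟨ cong sum (map-++ (cost C) (map a L) _) ⟩
  sum (map (cost C) (map a L) ++ map (cost C) (map d L ++ N))
    ≡⟨ sum-++ (map (cost C) (map a L)) _ ⟩
  sum (map (cost C) (map a L)) + sum (map (cost C) (map d L ++ N))
    ≡⟨ cong₂ _+_ (sum-over a) (cong sum (map-++ (cost C) (map d L) N)) ⟩
  ∑ (cost C ∘ a) + sum (map (cost C) (map d L) ++ map (cost C) N)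
    ≡⟨ cong (∑ (cost C ∘ a) +_) (sum-++ (map (cost C) (map d L)) _) ⟩
  ∑ (cost C ∘ a) + (sum (map (cost C) (map d L)) + sum (map (cost C) N))
    ≡⟨ cong (λ s → ∑ (cost C ∘ a) + (s + sum (map (cost C) N))) (sum-over d) ⟩
  ∑ (cost C ∘ a) + (∑ (cost C ∘ d) + sum (map (cost C) N))  ∎
  where
  open ≡-Reasoning
  L : List (Fin k)
  L = allFin k
  N : List (V k)
  N = nonTerminals k
  sum-over : (f : Fin k → V k) → sum (map (cost C) (map f L)) ≡ ∑ (cost C ∘ f)
  sum-over f = trans (cong sum (sym (map-∘ L))) (sum-map-allFin (cost C ∘ f))

-- `pairsWith` decides `l <? m` in a where-clause; the inferred type of the
-- inclusion into `pairsWith l` exposes that test to `with`.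
pairsWith-∋ : (l m : Fin k) .(l<m : l < m) → v l m l<m ∈ₗ pairsWith l
pairsWith-∋ {k} l m l<m
  with (v l m l<m ∈ₗ _ → v l m l<m ∈ₗ pairsWith l)
       ∋ (∈-concatMap⁺ _ {xs = allFin k} ∘ lose (∈-allFin m))
... | include with l <? m
...   | yes _   = include (here refl)
...   | no l≮m = ⊥-elim (l≮m (recompute (l <? m) l<m))

pairsWith-nonTerminal : (l : Fin k) {x : V k} → x ∈ₗ pairsWith l → isTerminal x ≡ false
pairsWith-nonTerminal {k} l x∈ with satisfied (∈-concatMap⁻ _ {xs = allFin k} x∈)
... | m , x∈test with l <? m
pairsWith-nonTerminal l x∈ | m , here refl | yes _ = refl

nonTerminals-nonTerminal : {x : V k} → x ∈ₗ nonTerminals k → isTerminal x ≡ false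
nonTerminals-nonTerminal {k} x∈ with satisfied (∈-concatMap⁻ pairsWith {xs = allFin k} x∈)
... | l , x∈pairs = pairsWith-nonTerminal l x∈pairs

v-∈-nonTerminals : (l m : Fin k) .(l<m : l < m) → v l m l<m ∈ₗ nonTerminals k
v-∈-nonTerminals {k} l m l<m =
  ∈-concatMap⁺ pairsWith {xs = allFin k} (lose (∈-allFin l) (pairsWith-∋ l m l<m))

vtx-∈-nonTerminals : {i j : Fin k} (i≢j : i ≢ j) → vtx i j i≢j ∈ₗ nonTerminals k
vtx-∈-nonTerminals {i = i} {j} i≢j with <-cmp i j
... | tri< i<j _ _ = v-∈-nonTerminals i j i<j
... | tri≈ _ i≡j _ = ⊥-elim (i≢j i≡j)
... | tri> _ _ j<i = v-∈-nonTerminals j i j<i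

weight-≥ : (C : VSet k) {x : V k} → x ∈ₗ nonTerminals k →
           ∑ (λ l → cost C (a l) + cost C (d l)) + cost C x ≤ weight C
weight-≥ {k} C {x} x∈ = begin
  ∑ (λ l → cost C (a l) + cost C (d l)) + cost C x
    ≡⟨ cong (_+ cost C x) (∑-distrib-+ (cost C ∘ a) (cost C ∘ d)) ⟩
  A + D + cost C x
    ≡⟨ +-assoc A D (cost C x) ⟩
  A + (D + cost C x)
    ≤⟨ +-monoʳ-≤ A (+-monoʳ-≤ D (sum-map-∈-≤ (cost C) x∈)) ⟩
  A + (D + sum (map (cost C) (nonTerminals k)))
    ≡⟨ sym (weight-decomposition C) ⟩
  weight C  ∎
  where
  open ≤-Reasoning
  A D : ℕ
  A = ∑ (cost C ∘ a)
  D = ∑ (cost C ∘ d)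

weight-⊆A : (C : VSet k) → (∀ l → d l ∉ C) → (∀ x → isTerminal x ≡ false → x ∉ C) →
            weight C ≡ ∑ (cost C ∘ a)
weight-⊆A {k} C D∩C≡∅ N∩C≡∅ = begin
  weight C
    ≡⟨ weight-decomposition C ⟩
  ∑ (cost C ∘ a) + (∑ (cost C ∘ d) + sum (map (cost C) N))
    ≡⟨ cong (∑ (cost C ∘ a) +_) (cong₂ _+_ D-cost N-cost) ⟩
  ∑ (cost C ∘ a) + 0
    ≡⟨ +-identityʳ _ ⟩
  ∑ (cost C ∘ a)  ∎
  where
  open ≡-Reasoning
  N : List (V k)
  N = nonTerminals k
  D-cost : ∑ (cost C ∘ d) ≡ 0
  D-cost = trans (sum-cong-≗ (cost-∉ C ∘ D∩C≡∅)) (sum-replicate-zero k)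
  N-cost : sum (map (cost C) N) ≡ 0
  N-cost = sum-map-zero (cost C) N (λ x x∈N → cost-∉ C (N∩C≡∅ x (nonTerminals-nonTerminal x∈N)))

vtx-< : {i j : Fin k} (i≢j : i ≢ j) .(i<j : i < j) → vtx i j i≢j ≡ v i j i<j
vtx-< {i = i} {j} i≢j i<j with <-cmp i j
... | tri< _ _ _   = refl
... | tri≈ _ i≡j _ = ⊥-elim (i≢j i≡j)
... | tri> _ _ j<i = ⊥-elim (<-asym j<i (recompute (i <? j) i<j))

vtx-> : {i j : Fin k} (i≢j : i ≢ j) .(j<i : j < i) → vtx i j i≢j ≡ v j i j<i
vtx-> {i = i} {j} i≢j j<i with <-cmp i j
... | tri< i<j _ _ = ⊥-elim (<-asym i<j (recompute (j <? i) j<i))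
... | tri≈ _ i≡j _ = ⊥-elim (i≢j i≡j)
... | tri> _ _ _   = refl

vtx-adj : {i j : Fin k} (i≢j : i ≢ j) → Adj (a i) (vtx i j i≢j) × Adj (vtx i j i≢j) (a j)
vtx-adj {i = i} {j} i≢j with <-cmp i j
... | tri< i<j _ _ = av₁ i j i<j , va₂ i j i<j
... | tri≈ _ i≡j _ = ⊥-elim (i≢j i≡j)
... | tri> _ _ j<i = av₂ j i j<i , va₁ j i j<i

Alive : VSet k → VSet k → V k → Set
Alive B C x = (x ∈ inGB B) × (x ∉ C)

∉B⇒∈inGB : (B : VSet k) {x : V k} → x ∉ B → x ∈ inGB B
∉B⇒∈inGB B {x} x∉B = trans (cong (λ b → isTerminal x ∨ not b) x∉B) (∨-zeroʳ (isTerminal x))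

≟-≡ : {l m : Fin k} → ⌊ l ≟ m ⌋ ≡ true ⇔ l ≡ m
≟-≡ {l = l} {m} = mk⇔ (toWitness {a? = l ≟ m} ∘ Equivalence.from T-≡)
                      (Equivalence.to T-≡ ∘ fromWitness {a? = l ≟ m})

≟-≢ : {l m : Fin k} → not ⌊ l ≟ m ⌋ ≡ true ⇔ l ≢ m
≟-≢ {l = l} {m} = mk⇔ (toWitnessFalse {a? = l ≟ m} ∘ Equivalence.from T-≡)
                      (Equivalence.to T-≡ ∘ fromWitnessFalse {a? = l ≟ m})

aᵢ∈X : (i j : Fin k) → a i ∈ X i j
aᵢ∈X i j = Equivalence.from ≟-≡ refl

d∈X : {i j l : Fin k} → l ≢ j → d l ∈ X i j
d∈X = Equivalence.from ≟-≢

a∈T∖X : {i j l : Fin k} → l ≢ i → a l ∈ TMinus (X i j)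
a∈T∖X = Equivalence.from ≟-≢

module _ {B : VSet k} {i j : Fin k} {C : VSet k} (C-cut : IsCut B (X i j) (TMinus (X i j)) C) where

  private
    separates : ∀ p q → p ∈ X i j → p ∉ C → q ∈ TMinus (X i j) → q ∉ C → ¬ Reach (Alive B C) p q
    separates = proj₂ C-cut

  pair-cost-≥ : (l : Fin k) → l ≢ i → l ≢ j → 2 ≤ cost C (a l) + cost C (d l)
  pair-cost-≥ l l≢i l≢j with C (a l) in aₗ∉C | C (d l) in dₗ∉C
  ... | true  | _     = m≤m+n 2 _
  ... | false | true  = s≤s (s≤s z≤n)
  ... | false | false =
    ⊥-elim (separates (d l) (a l) (d∈X {i = i} l≢j) dₗ∉C (a∈T∖X {j = j} l≢i) aₗ∉C
                      (step (refl , dₗ∉C) (da l) (here (refl , aₗ∉C))))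

  triangle-cost-≥ : (i≢j : i ≢ j) → vtx i j i≢j ∉ B →
                    1 ≤ cost C (a i) + cost C (a j) + cost C (vtx i j i≢j)
  triangle-cost-≥ i≢j vᵢⱼ∉B with C (a i) in aᵢ∉C | C (a j) in aⱼ∉C | C (vtx i j i≢j) in vᵢⱼ∉C
  ... | true  | _     | _     = s≤s z≤n
  ... | false | true  | _     = s≤s z≤n
  ... | false | false | true  = w-positive (vtx i j i≢j)
  ... | false | false | false =
    ⊥-elim (separates (a i) (a j) (aᵢ∈X i j) aᵢ∉C (a∈T∖X {j = j} (i≢j ∘ sym)) aⱼ∉C
                      (step (refl , aᵢ∉C) (proj₁ (vtx-adj i≢j))
                      (step (∉B⇒∈inGB B vᵢⱼ∉B , vᵢⱼ∉C) (proj₂ (vtx-adj i≢j))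
                      (here (refl , aⱼ∉C)))))

cut-weight-≥ : {B : VSet (suc (suc n))} {i j : Fin (suc (suc n))} {C : VSet (suc (suc n))} →
               IsCut B (X i j) (TMinus (X i j)) C → (i≢j : i ≢ j) →
               n * 2 + (cost C (a i) + cost C (a j) + cost C (vtx i j i≢j)) ≤ weight C
cut-weight-≥ {n} {i = i} {j} {C} C-cut i≢j = begin
  n * 2 + (aᵢ + aⱼ + cᵥ)    ≡⟨ sym (+-assoc (n * 2) (aᵢ + aⱼ) cᵥ) ⟩
  n * 2 + (aᵢ + aⱼ) + cᵥ    ≤⟨ +-monoˡ-≤ cᵥ (+-monoʳ-≤ (n * 2) aᵢ+aⱼ≤pᵢ+pⱼ) ⟩
  n * 2 + (p i + p j) + cᵥ  ≤⟨ +-monoˡ-≤ cᵥ (∑-≥-except₂ p i≢j 2 (pair-cost-≥ C-cut)) ⟩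
  ∑ p + cᵥ                  ≤⟨ weight-≥ C (vtx-∈-nonTerminals i≢j) ⟩
  weight C                  ∎
  where
  open ≤-Reasoning
  p : Fin (suc (suc n)) → ℕ
  p l = cost C (a l) + cost C (d l)
  aᵢ aⱼ cᵥ : ℕ
  aᵢ = cost C (a i)
  aⱼ = cost C (a j)
  cᵥ = cost C (vtx i j i≢j)
  aᵢ+aⱼ≤pᵢ+pⱼ : aᵢ + aⱼ ≤ p i + p j
  aᵢ+aⱼ≤pᵢ+pⱼ = +-mono-≤ (m≤m+n aᵢ _) (m≤m+n aⱼ _)

A-except : Fin k → Fin k → VSet k
A-except i j (a l)     = not ⌊ l ≟ i ⌋ ∧ not ⌊ l ≟ j ⌋
A-except i j (d _)     = false
A-except i j (v _ _ _) = false

A-except-∌ˡ : (i j : Fin k) → a i ∉ A-except i j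
A-except-∌ˡ i j rewrite Equivalence.from (≟-≡ {l = i}) refl = refl

A-except-∌ʳ : (i j : Fin k) → a j ∉ A-except i j
A-except-∌ʳ i j rewrite Equivalence.from (≟-≡ {l = j}) refl = ∧-zeroʳ _

A-except-∋ : {i j l : Fin k} → l ≢ i → l ≢ j → a l ∈ A-except i j
A-except-∋ l≢i l≢j = cong₂ _∧_ (Equivalence.from ≟-≢ l≢i) (Equivalence.from ≟-≢ l≢j)

A-except-∌⇒ : {i j l : Fin k} → a l ∉ A-except i j → l ≡ i ⊎ l ≡ j
A-except-∌⇒ {i = i} {j} {l} aₗ∉ with l ≟ i | l ≟ j
... | yes l≡i | _       = inj₁ l≡i
... | no _    | yes l≡j = inj₂ l≡j
... | no _    | no _    = case aₗ∉ of λ ()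

weight-A-except : {i j : Fin (suc (suc n))} → i ≢ j → weight (A-except i j) ≡ n * 2
weight-A-except {n} {i} {j} i≢j = begin
  weight C₀
    ≡⟨ weight-⊆A C₀ (λ _ → refl) N∩C₀≡∅ ⟩
  ∑ (cost C₀ ∘ a)
    ≡⟨ ∑-≡-except₂ (cost C₀ ∘ a) i≢j 2 cost-elsewhere ⟩
  cost C₀ (a i) + (cost C₀ (a j) + n * 2)
    ≡⟨ cong₂ (λ cᵢ cⱼ → cᵢ + (cⱼ + n * 2)) cost-aᵢ cost-aⱼ ⟩
  n * 2  ∎
  where
  open ≡-Reasoning
  C₀ : VSet (suc (suc n))
  C₀ = A-except i j
  cost-elsewhere : ∀ l → l ≢ i → l ≢ j → cost C₀ (a l) ≡ 2
  cost-elsewhere l l≢i l≢j = cong (λ b → if b then 2 else 0) (A-except-∋ l≢i l≢j)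
  cost-aᵢ : cost C₀ (a i) ≡ 0
  cost-aᵢ = cost-∉ C₀ {a i} (A-except-∌ˡ i j)
  cost-aⱼ : cost C₀ (a j) ≡ 0
  cost-aⱼ = cost-∉ C₀ {a j} (A-except-∌ʳ i j)
  N∩C₀≡∅ : ∀ x → isTerminal x ≡ false → x ∉ C₀
  N∩C₀≡∅ (v _ _ _) _ = refl

-- A superset of X_{i,j} that no edge of G_k^B ∖ (A ∖ {a_i, a_j}) leaves when v_{i,j} ∈ B.
XSide : Fin k → Fin k → V k → Set
XSide i j (a l)     = l ≡ i
XSide i j (d l)     = l ≢ j
XSide i j (v l m _) = l ≡ i ⊎ m ≡ i

Reach-source : {ok : V k → Set} {x y : V k} → Reach ok x y → ok x
Reach-source (here ok-x)     = ok-x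
Reach-source (step ok-x _ _) = ok-x

Reach-preserves : {ok S : V k → Set} → (∀ {x y} → ok x → ok y → Adj x y → S x → S y) →
                  {x y : V k} → Reach ok x y → S x → S y
Reach-preserves step-S (here _)           S-x = S-x
Reach-preserves step-S (step ok-x x~y y⇝z) S-x =
  Reach-preserves step-S y⇝z (step-S ok-x (Reach-source y⇝z) x~y S-x)

X⇒XSide : (i j : Fin k) (x : V k) → x ∈ X i j → XSide i j x
X⇒XSide i j (a l) x∈X = Equivalence.to ≟-≡ x∈X
X⇒XSide i j (d l) x∈X = Equivalence.to ≟-≢ x∈X

T∖X⇒¬XSide : (i j : Fin k) (x : V k) → x ∈ TMinus (X i j) → ¬ XSide i j x
T∖X⇒¬XSide i j (a l) x∈T∖X = Equivalence.to ≟-≢ x∈T∖X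
T∖X⇒¬XSide i j (d l) x∈T∖X l≢j =
  l≢j (Equivalence.to ≟-≡ (trans (sym (not-involutive _)) x∈T∖X))

module _ {B : VSet k} {i j : Fin k} (i≢j : i ≢ j) (vᵢⱼ∈B : vtx i j i≢j ∈ B) where

  private
    Alive₀ : V k → Set
    Alive₀ = Alive B (A-except i j)

    vᵢⱼ-dead : ∀ {l m} .{l<m : l < m} → vtx i j i≢j ≡ v l m l<m → ¬ Alive₀ (v l m l<m)
    vᵢⱼ-dead vᵢⱼ≡ (alive , _) =
      case trans (sym (cong not vᵢⱼ∈B)) (subst (λ x → not (B x) ≡ true) (sym vᵢⱼ≡) alive) of λ ()

    a-alive : ∀ {l} → Alive₀ (a l) → l ≡ i ⊎ l ≡ j
    a-alive = A-except-∌⇒ ∘ proj₂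

  XSide-step : ∀ {x y} → Alive₀ x → Alive₀ y → Adj x y → XSide i j x → XSide i j y
  XSide-step _ _ (ad l) l≡i l≡j = i≢j (trans (sym l≡i) l≡j)
  XSide-step _ alive-y (da l) l≢j with a-alive alive-y
  ... | inj₁ l≡i = l≡i
  ... | inj₂ l≡j = ⊥-elim (l≢j l≡j)
  XSide-step _ _ (va₁ l m l<m) (inj₁ l≡i) = l≡i
  XSide-step alive-x alive-y (va₁ l m l<m) (inj₂ refl) with a-alive alive-y
  ... | inj₁ l≡i = l≡i
  ... | inj₂ refl = ⊥-elim (vᵢⱼ-dead (vtx-> i≢j l<m) alive-x)
  XSide-step _ _ (va₂ l m l<m) (inj₂ m≡i) = m≡i
  XSide-step alive-x alive-y (va₂ l m l<m) (inj₁ refl) with a-alive alive-y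
  ... | inj₁ m≡i = m≡i
  ... | inj₂ refl = ⊥-elim (vᵢⱼ-dead (vtx-< i≢j l<m) alive-x)
  XSide-step _ _ (av₁ l m l<m) l≡i = inj₁ l≡i
  XSide-step _ _ (av₂ l m l<m) m≡i = inj₂ m≡i

  A-except-cut : IsCut B (X i j) (TMinus (X i j)) (A-except i j)
  A-except-cut = A-except⊆GB , separates
    where
    A-except⊆GB : ∀ x → x ∈ A-except i j → x ∈ inGB B
    A-except⊆GB (a _) _ = refl
    separates : ∀ p q → p ∈ X i j → p ∉ A-except i j → q ∈ TMinus (X i j) → q ∉ A-except i j →
                ¬ Reach Alive₀ p q
    separates p q p∈X _ q∈T∖X _ p⇝q =
      T∖X⇒¬XSide i j q q∈T∖X (Reach-preserves XSide-step p⇝q (X⇒XSide i j p p∈X))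

mincut≡⇔vᵢⱼ∈B : (B : VSet (suc (suc n))) {i j : Fin (suc (suc n))} (i≢j : i ≢ j) →
                MinCutIs B (X i j) (TMinus (X i j)) (n * 2) ⇔ (vtx i j i≢j ∈ B)
mincut≡⇔vᵢⱼ∈B {n} B {i} {j} i≢j = mk⇔ minimal⇒vᵢⱼ∈B vᵢⱼ∈B⇒minimal
  where
  minimal⇒vᵢⱼ∈B : MinCutIs B (X i j) (TMinus (X i j)) (n * 2) → vtx i j i≢j ∈ B
  minimal⇒vᵢⱼ∈B ((C , C-cut , wC≡) , _) with B (vtx i j i≢j) in vᵢⱼ∉B
  ... | true  = refl
  ... | false = ⊥-elim (m+1+n≰m (n * 2) (begin
    n * 2 + 1                ≤⟨ +-monoʳ-≤ (n * 2) (triangle-cost-≥ C-cut i≢j vᵢⱼ∉B) ⟩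
    n * 2 + (cost C (a i) + cost C (a j) + cost C (vtx i j i≢j))  ≤⟨ cut-weight-≥ C-cut i≢j ⟩
    weight C                 ≡⟨ wC≡ ⟩
    n * 2                    ∎))
    where open ≤-Reasoning
  vᵢⱼ∈B⇒minimal : vtx i j i≢j ∈ B → MinCutIs B (X i j) (TMinus (X i j)) (n * 2)
  vᵢⱼ∈B⇒minimal vᵢⱼ∈B =
    (A-except i j , A-except-cut i≢j vᵢⱼ∈B , weight-A-except i≢j) ,
    λ C C-cut → ≤-trans (m≤m+n (n * 2) _) (cut-weight-≥ C-cut i≢j)

2*[2+n]∸4≡n*2 : (n : ℕ) → 2 * suc (suc n) ∸ 4 ≡ n * 2
2*[2+n]∸4≡n*2 n =
  trans (cong (_∸ 4) (trans (*-distribˡ-+ 2 2 n) (cong (4 +_) (*-comm 2 n)))) (m+n∸m≡n 4 (n * 2))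

lemma4p8 : (k : ℕ) → 2 ≤ k → (B : VSet k) →
    (∀ l → B (a l) ≡ false) → (∀ l → B (d l) ≡ false) →
    (i j : Fin k) → (i≢j : i ≢ j) →
    MinCutIs B (X i j) (TMinus (X i j)) (2 * k ∸ 4) ⇔ (vtx i j i≢j ∈ B)
lemma4p8 (suc (suc n)) (s≤s (s≤s z≤n)) B _ _ i j i≢j
  rewrite 2*[2+n]∸4≡n*2 n = mincut≡⇔vᵢⱼ∈B B i≢j
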